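{- Let $F$ be a forest on $n$ vertices and let $\vec{\lambda}=(\lambda_1,\dots,\lambda_n)$ be a labeling of the vertices of $F$ by non-negative integers. Then the bounded degree complex $\mathrm{BD}^{\vec{\lambda}}(F)$ is a combinatorial grape.
   Context: For a simple graph $G$ with vertex set $\{v_1,\dots,v_n\}$ and a labeling $\vec{\lambda}=(\lambda_1,\dots,\lambda_n)$ of its vertices by non-negative integers, the bounded degree complex $\mathrm{BD}^{\vec{\lambda}}(G)$ is the simplicial complex whose vertices are the edges of $G$ and whose faces are the subsets $H\subseteq E(G)$ such that, for each $i$, the degree of $v_i$ in the subgraph with edge set $H$ is at most $\lambda_i$. For a simplicial complex $K$ and a vertex $a$, the link is $(K:a)=\{\tau\in K: a\notin\tau,\ \tau\cup\{a\}\in K\}$ and the deletion is $(K,a)=\{\tau\in K: a\notin\tau\}$. A cone is a complex of the form $K'\ast\{\emptyset,b\}$ for a complex $K'$ and a vertex $b$ (a complex is "contained in a cone contained in $(K,a)$" if there is a subcomplex of $(K,a)$ which is a cone and contains $(K:a)$). A simplicial complex $K$ is a combinatorial grape if either (1) there is a vertex $a$ of $K$ such that $(K:a)$ is contained in a cone contained in $(K,a)$ and both $(K:a)$ and $(K,a)$ are combinatorial grapes, or (2) $K$ has at most one vertex. -}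

module Defs where

open import Data.Nat using (ℕ; zero; suc; _≤_)
open import Data.Fin using (Fin; zero; suc; _<_; inject₁; fromℕ; _≟_)
open import Data.Fin.Subset using (Subset; _∈_; _∉_; ⁅_⁆; _∪_; _∩_; ∣_∣; ⊥)
open import Data.Vec using (tabulate)
open import Data.Bool using (_∨_)
open import Data.Product using (Σ; _×_; _,_; proj₁; proj₂)
open import Data.Sum using (_⊎_)
open import Relation.Nullary using (¬_; does)
open import Relation.Binary.PropositionalEquality using (_≡_)
open import Function using (Injective)

-- The edges are indexed by Fin (edgeCount G); edge e joins the two
-- distinct vertices proj₁ (ends e) < proj₂ (ends e); distinct indices
-- give distinct edges (no multi-edges).

record SimpleGraph (n : ℕ) : Set where
  field
    edgeCount : ℕ
    ends      : Fin edgeCount → Fin n × Fin n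
    ordered   : ∀ e → proj₁ (ends e) < proj₂ (ends e)
    noMulti   : Injective _≡_ _≡_ ends
open SimpleGraph public

Adj : ∀ {n} (G : SimpleGraph n) → Fin n → Fin n → Set
Adj G u v = Σ (Fin (edgeCount G)) λ e → ends G e ≡ (u , v) ⊎ ends G e ≡ (v , u)

-- a cycle of length k+3 (k ≥ 0): distinct vertices f 0, …, f (k+2),
-- consecutive ones adjacent, and f (k+2) adjacent to f 0.
record Cycle {n} (G : SimpleGraph n) : Set where
  field
    k      : ℕ
    vert   : Fin (suc (suc (suc k))) → Fin n
    inj    : Injective _≡_ _≡_ vert
    step   : ∀ (i : Fin (suc (suc k))) → Adj G (vert (inject₁ i)) (vert (suc i))
    close  : Adj G (vert (fromℕ (suc (suc k)))) (vert zero)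

IsForest : ∀ {n} → SimpleGraph n → Set
IsForest G = ¬ Cycle G

Complex : ℕ → Set₁
Complex m = Subset m → Set

IsSimplicialComplex : ∀ {m} → Complex m → Set
IsSimplicialComplex K = K ⊥ × (∀ σ τ → τ Data.Fin.Subset.⊆ σ → K σ → K τ)

IsVertex : ∀ {m} → Complex m → Fin m → Set
IsVertex K a = K ⁅ a ⁆

link : ∀ {m} → Complex m → Fin m → Complex m
link K a τ = a ∉ τ × K (τ ∪ ⁅ a ⁆)

deletion : ∀ {m} → Complex m → Fin m → Complex m
deletion K a τ = a ∉ τ × K τ

_⊑_ : ∀ {m} → Complex m → Complex m → Set
K ⊑ L = ∀ τ → K τ → L τ

-- the join K' ∗ {∅ , b}, for b not a vertex of K'
join-apex : ∀ {m} → Complex m → Fin m → Complex m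
join-apex K' b τ = Σ (Subset _) λ σ → K' σ × (τ ≡ σ ⊎ τ ≡ σ ∪ ⁅ b ⁆)

IsCone : ∀ {m} → Complex m → Set₁
IsCone {m} C = Σ (Complex m) λ K' → Σ (Fin m) λ b →
  IsSimplicialComplex K' × (∀ σ → K' σ → b ∉ σ) ×
  (C ⊑ join-apex K' b) × (join-apex K' b ⊑ C)

LinkInCone : ∀ {m} → Complex m → Fin m → Set₁
LinkInCone {m} K a = Σ (Complex m) λ C →
  IsCone C × (link K a ⊑ C) × (C ⊑ deletion K a)

AtMostOneVertex : ∀ {m} → Complex m → Set
AtMostOneVertex K = ∀ u v → IsVertex K u → IsVertex K v → u ≡ v

data Grape {m} : Complex m → Set₁ where
  decompose : ∀ {K} (a : Fin m) → IsVertex K a → LinkInCone K a →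
              Grape (link K a) → Grape (deletion K a) → Grape K
  small     : ∀ {K} → AtMostOneVertex K → Grape K

incident : ∀ {n} (G : SimpleGraph n) → Fin n → Subset (edgeCount G)
incident G v = tabulate λ e → does (v ≟ proj₁ (ends G e)) ∨ does (v ≟ proj₂ (ends G e))

degree : ∀ {n} (G : SimpleGraph n) → Subset (edgeCount G) → Fin n → ℕ
degree G H v = ∣ H ∩ incident G v ∣

BD : ∀ {n} → (Fin n → ℕ) → (G : SimpleGraph n) → Complex (edgeCount G)
BD λ' G H = ∀ i → degree G H i ≤ λ' i

-- Generalise to the complexes BD↾ S λ of edge sets τ ⊆ S with bounded
-- degrees and induct on ∣ S ∣: the deletion of an edge b is BD↾ (S - b) λ and
-- its link is BD↾ (S - b) λ′, with λ′ lowered by one at the two ends of b.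
-- Edges of S that are not vertices of the complex can be discarded. If two
-- edges remain, the forest S has a leaf v with pendant edge a = vw; let b be
-- another edge at w, or any other edge if a is isolated. Exchanging b for a
-- in a face never breaks a degree bound, so coning the faces of the link at b
-- that avoid a off with apex a gives a cone inside the deletion containing
-- the link.

module Submission where

open import Defs
open import Data.Nat using (ℕ; zero; suc; _+_; _∸_; _≤_; _<_; _≤?_; z≤n)
open import Data.Nat.Properties
open import Data.Nat.Induction using (<-rec; <-wellFounded)
open import Data.Bool using (true; false)
open import Data.Bool.Properties using (∨-identityʳ)
open import Data.Fin as Fin using (Fin; zero; suc; toℕ)
open import Data.Fin.Properties using (toℕ-injective; toℕ<n; toℕ-fromℕ; toℕ-inject₁; pigeonhole; any?; all?)
open import Data.Fin.Subset
open import Data.Fin.Subset.Properties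
open import Data.Vec using ([]; _∷_; here; there)
open import Data.Vec.Properties using ([]=⇒lookup; lookup⇒[]=; lookup∘tabulate)
open import Data.Product using (Σ; ∃; ∃₂; _×_; _,_; proj₁; proj₂; swap)
open import Data.Sum using (_⊎_; inj₁; inj₂) renaming (swap to ⊎-swap)
open import Data.Empty using (⊥-elim)
open import Function using (_∘_; case_of_)
open import Relation.Nullary using (¬_; yes; no; Dec; proof)
open import Relation.Nullary.Reflects using (Reflects; invert)
open import Relation.Nullary.Decidable using (_×-dec_; _⊎-dec_; ¬?; dec-true; decidable-stable)
open import Relation.Unary using (Decidable)
open import Relation.Binary.PropositionalEquality
open import Relation.Binary.Definitions using (tri<; tri≈; tri>)
open import Relation.Binary.Construct.On using (wellFounded)
open import Induction.WellFounded using (module All)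

private variable
  m : ℕ

Disjoint : Subset m → Subset m → Set
Disjoint p q = ∀ {x} → x ∈ p → x ∉ q

Disjoint-tail : ∀ {s t} {p q : Subset m} → Disjoint (s ∷ p) (t ∷ q) → Disjoint p q
Disjoint-tail d x∈p x∈q = d (there x∈p) (there x∈q)

∣[p∪q]∩r∣≡∣p∩r∣+∣q∩r∣ : (p q r : Subset m) → Disjoint p q → ∣ (p ∪ q) ∩ r ∣ ≡ ∣ p ∩ r ∣ + ∣ q ∩ r ∣
∣[p∪q]∩r∣≡∣p∩r∣+∣q∩r∣ []          []          []          _ = refl
∣[p∪q]∩r∣≡∣p∩r∣+∣q∩r∣ (true ∷ p)  (true ∷ q)  r           d = ⊥-elim (d here here)
∣[p∪q]∩r∣≡∣p∩r∣+∣q∩r∣ (true ∷ p)  (false ∷ q) (true ∷ r)  d =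
  cong suc (∣[p∪q]∩r∣≡∣p∩r∣+∣q∩r∣ p q r (Disjoint-tail d))
∣[p∪q]∩r∣≡∣p∩r∣+∣q∩r∣ (true ∷ p)  (false ∷ q) (false ∷ r) d =
  ∣[p∪q]∩r∣≡∣p∩r∣+∣q∩r∣ p q r (Disjoint-tail d)
∣[p∪q]∩r∣≡∣p∩r∣+∣q∩r∣ (false ∷ p) (true ∷ q)  (true ∷ r)  d =
  trans (cong suc (∣[p∪q]∩r∣≡∣p∩r∣+∣q∩r∣ p q r (Disjoint-tail d))) (sym (+-suc _ _))
∣[p∪q]∩r∣≡∣p∩r∣+∣q∩r∣ (false ∷ p) (true ∷ q)  (false ∷ r) d =
  ∣[p∪q]∩r∣≡∣p∩r∣+∣q∩r∣ p q r (Disjoint-tail d)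
∣[p∪q]∩r∣≡∣p∩r∣+∣q∩r∣ (false ∷ p) (false ∷ q) (_ ∷ r)     d =
  ∣[p∪q]∩r∣≡∣p∩r∣+∣q∩r∣ p q r (Disjoint-tail d)

x∈p⇒∣⁅x⁆∩p∣≡1 : ∀ {x} {p : Subset m} → x ∈ p → ∣ ⁅ x ⁆ ∩ p ∣ ≡ 1
x∈p⇒∣⁅x⁆∩p∣≡1 {m = suc m} {p = _ ∷ p} here = cong suc (trans (cong ∣_∣ (∩-zeroˡ p)) (∣⊥∣≡0 m))
x∈p⇒∣⁅x⁆∩p∣≡1 (there x∈p) = x∈p⇒∣⁅x⁆∩p∣≡1 x∈p

x∉p⇒∣⁅x⁆∩p∣≡0 : ∀ {x} (p : Subset m) → x ∉ p → ∣ ⁅ x ⁆ ∩ p ∣ ≡ 0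
x∉p⇒∣⁅x⁆∩p∣≡0 {m = suc m} {zero} (false ∷ p) _ = trans (cong ∣_∣ (∩-zeroˡ p)) (∣⊥∣≡0 m)
x∉p⇒∣⁅x⁆∩p∣≡0 {m = suc m} {zero} (true ∷ p) x∉p = ⊥-elim (x∉p here)
x∉p⇒∣⁅x⁆∩p∣≡0 {x = suc x} (_ ∷ p) x∉p = x∉p⇒∣⁅x⁆∩p∣≡0 p (x∉p ∘ there)

x∈p─q⇒x∉q : ∀ {x} (p q : Subset m) → x ∈ p ─ q → x ∉ q
x∈p─q⇒x∉q (true ∷ p) (false ∷ q) here ()
x∈p─q⇒x∉q (_ ∷ p)    (_ ∷ q)     (there x∈p─q) (there x∈q) = x∈p─q⇒x∉q p q x∈p─q x∈q

x∈p-y⇒x≢y : ∀ {x y} {p : Subset m} → x ∈ p - y → x ≢ y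
x∈p-y⇒x≢y {y = y} {p} x∈p-y refl = x∈p─q⇒x∉q p ⁅ y ⁆ x∈p-y (x∈⁅x⁆ y)

x∈p-y⇒x∈p : ∀ {x y} {p : Subset m} → x ∈ p - y → x ∈ p
x∈p-y⇒x∈p {y = y} {p} = p─q⊆p p ⁅ y ⁆

x∈p⇒p-x∪⁅x⁆≡p : ∀ {x} {p : Subset m} → x ∈ p → (p - x) ∪ ⁅ x ⁆ ≡ p
x∈p⇒p-x∪⁅x⁆≡p {p = true ∷ p} here = cong (true ∷_) (trans (∪-identityʳ _) (p─⊥≡p p))
x∈p⇒p-x∪⁅x⁆≡p {p = s ∷ p} (there x∈p) = cong₂ _∷_ (∨-identityʳ s) (x∈p⇒p-x∪⁅x⁆≡p x∈p)

x∈p⇒⁅x⁆⊆p : ∀ {x} {p : Subset m} → x ∈ p → ⁅ x ⁆ ⊆ p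
x∈p⇒⁅x⁆⊆p {x = x} {p} x∈p y∈⁅x⁆ = subst (_∈ p) (sym (x∈⁅y⁆⇒x≡y x y∈⁅x⁆)) x∈p

∪-lub : {p q r : Subset m} → p ⊆ r → q ⊆ r → p ∪ q ⊆ r
∪-lub {p = p} {q} p⊆r q⊆r x∈p∪q with x∈p∪q⁻ p q x∈p∪q
... | inj₁ x∈p = p⊆r x∈p
... | inj₂ x∈q = q⊆r x∈q

∪-monoˡ-⊆ : {p q : Subset m} (r : Subset m) → p ⊆ q → p ∪ r ⊆ q ∪ r
∪-monoˡ-⊆ r p⊆q = ∪-lub (p⊆p∪q r ∘ p⊆q) (q⊆p∪q _ r)

∣p∩r∣≤∣q∩r∣ : {p q : Subset m} (r : Subset m) → p ⊆ q → ∣ p ∩ r ∣ ≤ ∣ q ∩ r ∣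
∣p∩r∣≤∣q∩r∣ {p = p} r p⊆q = p⊆q⇒∣p∣≤∣q∣ λ x∈p∩r →
  let x∈p , x∈r = x∈p∩q⁻ p r x∈p∩r in x∈p∩q⁺ (p⊆q x∈p , x∈r)

_≋_ : Complex m → Complex m → Set
K ≋ L = K ⊑ L × L ⊑ K

⊑-trans : {K L M : Complex m} → K ⊑ L → L ⊑ M → K ⊑ M
⊑-trans K⊑L L⊑M τ = L⊑M τ ∘ K⊑L τ

≋-sym : {K L : Complex m} → K ≋ L → L ≋ K
≋-sym = swap

≋-trans : {K L M : Complex m} → K ≋ L → L ≋ M → K ≋ M
≋-trans (K⊑L , L⊑K) (L⊑M , M⊑L) = ⊑-trans K⊑L L⊑M , ⊑-trans M⊑L L⊑K

IsDownClosed : Complex m → Set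
IsDownClosed K = ∀ σ τ → τ ⊆ σ → K σ → K τ

link-mono : ∀ {K L : Complex m} {a} → K ⊑ L → link K a ⊑ link L a
link-mono K⊑L τ (a∉τ , τ∪a∈K) = a∉τ , K⊑L _ τ∪a∈K

deletion-mono : ∀ {K L : Complex m} {a} → K ⊑ L → deletion K a ⊑ deletion L a
deletion-mono K⊑L τ (a∉τ , τ∈K) = a∉τ , K⊑L τ τ∈K

LinkInCone-resp-≋ : ∀ {K L : Complex m} {a} → K ≋ L → LinkInCone K a → LinkInCone L a
LinkInCone-resp-≋ (K⊑L , L⊑K) (C , C-cone , link⊑C , C⊑deletion) =
  C , C-cone , ⊑-trans (link-mono L⊑K) link⊑C , ⊑-trans C⊑deletion (deletion-mono K⊑L)

Grape-resp-≋ : {K L : Complex m} → K ≋ L → Grape K → Grape L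
Grape-resp-≋ K≋L@(K⊑L , L⊑K) (decompose a a∈K cone grapeLink grapeDeletion) =
  decompose a (K⊑L _ a∈K) (LinkInCone-resp-≋ K≋L cone)
    (Grape-resp-≋ (link-mono K⊑L , link-mono L⊑K) grapeLink)
    (Grape-resp-≋ (deletion-mono K⊑L , deletion-mono L⊑K) grapeDeletion)
Grape-resp-≋ (_ , L⊑K) (small atMostOne) =
  small λ u v u∈L v∈L → atMostOne u v (L⊑K _ u∈L) (L⊑K _ v∈L)

¬IsVertex⇒≋deletion : ∀ {K : Complex m} {a} → IsDownClosed K → ¬ IsVertex K a → K ≋ deletion K a
¬IsVertex⇒≋deletion {a = a} down a∉K =
  (λ τ τ∈K → (λ a∈τ → a∉K (down τ ⁅ a ⁆ (x∈p⇒⁅x⁆⊆p a∈τ) τ∈K)) , τ∈K) , (λ _ → proj₂)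

Replaceable : Complex m → Fin m → Fin m → Set
Replaceable K b a = ∀ σ → a ∉ σ → b ∉ σ → K (σ ∪ ⁅ b ⁆) → K (σ ∪ ⁅ a ⁆)

replaceable⇒LinkInCone : ∀ {K : Complex m} {a b} → IsDownClosed K → a ≢ b →
                         IsVertex K b → Replaceable K b a → LinkInCone K b
replaceable⇒LinkInCone {m} {K} {a} {b} down a≢b b∈K replace =
  join-apex base a , (base , a , (base-∅ , base-down) , (λ _ → proj₁) , (λ _ x → x) , (λ _ x → x)) ,
  link⊑cone , cone⊑deletion
  where
  base : Complex m
  base σ = a ∉ σ × link K b σ

  base-∅ : base ⊥
  base-∅ = ∉⊥ , ∉⊥ , down ⁅ b ⁆ (⊥ ∪ ⁅ b ⁆) (∪-lub (⊆-min _) ⊆-refl) b∈K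

  base-down : IsDownClosed base
  base-down σ τ τ⊆σ (a∉σ , b∉σ , σ∪b∈K) =
    a∉σ ∘ τ⊆σ , b∉σ ∘ τ⊆σ , down _ _ (∪-monoˡ-⊆ ⁅ b ⁆ τ⊆σ) σ∪b∈K

  link⊑cone : link K b ⊑ join-apex base a
  link⊑cone τ (b∉τ , τ∪b∈K) with a ∈? τ
  ... | no a∉τ = τ , (a∉τ , b∉τ , τ∪b∈K) , inj₁ refl
  ... | yes a∈τ =
    τ - a ,
    ((λ a∈τ-a → x∈p-y⇒x≢y a∈τ-a refl) , b∉τ ∘ x∈p-y⇒x∈p , down _ _ (∪-monoˡ-⊆ ⁅ b ⁆ x∈p-y⇒x∈p) τ∪b∈K) ,
    inj₂ (sym (x∈p⇒p-x∪⁅x⁆≡p a∈τ))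

  cone⊑deletion : join-apex base a ⊑ deletion K b
  cone⊑deletion τ (σ , (_ , b∉σ , σ∪b∈K) , inj₁ refl) = b∉σ , down _ _ (p⊆p∪q _) σ∪b∈K
  cone⊑deletion τ (σ , (a∉σ , b∉σ , σ∪b∈K) , inj₂ refl) = b∉σ∪a , replace σ a∉σ b∉σ σ∪b∈K
    where
    b∉σ∪a : b ∉ σ ∪ ⁅ a ⁆
    b∉σ∪a b∈σ∪a with x∈p∪q⁻ σ ⁅ a ⁆ b∈σ∪a
    ... | inj₁ b∈σ = b∉σ b∈σ
    ... | inj₂ b∈⁅a⁆ = a≢b (sym (x∈⁅y⁆⇒x≡y a b∈⁅a⁆))

leastWitness : ∀ {P : ℕ → Set} → Decidable P → ∀ {j} → P j →
               ∃ λ j₀ → P j₀ × (∀ {k} → k < j₀ → ¬ P k)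
leastWitness {P} P? {j} = <-rec (λ j → P j → ∃ λ j₀ → P j₀ × (∀ {k} → k < j₀ → ¬ P k)) search j
  where
  search : ∀ j → (∀ {k} → k < j → P k → ∃ λ j₀ → P j₀ × (∀ {k} → k < j₀ → ¬ P k)) →
           P j → ∃ λ j₀ → P j₀ × (∀ {k} → k < j₀ → ¬ P k)
  search j smaller Pj with anyUpTo? P? j
  ... | yes (k , k<j , Pk) = smaller k<j Pk
  ... | no none = j , Pj , λ k<j Pk → none (_ , k<j , Pk)

module _ {n} (q : ℕ → Fin n) where
  private
    Repeats : ℕ → Set
    Repeats j = ∃ λ i → i < j × q i ≡ q j

    Repeats? : Decidable Repeats
    Repeats? j = anyUpTo? (λ i → q i Fin.≟ q j) j

  -- By pigeonhole some value repeats among q 0, …, q n; take the first repetition.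
  firstRepetition : ∃₂ λ i j → i < j × q i ≡ q j × (∀ {x y} → x < j → y < j → q x ≡ q y → x ≡ y)
  firstRepetition with pigeonhole (n<1+n n) (q ∘ toℕ)
  ... | i , j , i<j , qi≡qj with leastWitness Repeats? {toℕ j} (toℕ i , i<j , qi≡qj)
  ... | j₀ , (i₀ , i₀<j₀ , qi₀≡qj₀) , noEarlier = i₀ , j₀ , i₀<j₀ , qi₀≡qj₀ , injective
    where
    injective : ∀ {x y} → x < j₀ → y < j₀ → q x ≡ q y → x ≡ y
    injective {x} {y} x<j₀ y<j₀ qx≡qy with <-cmp x y
    ... | tri< x<y _ _ = ⊥-elim (noEarlier y<j₀ (x , x<y , qx≡qy))
    ... | tri≈ _ x≡y _ = x≡y
    ... | tri> _ _ y<x = ⊥-elim (noEarlier x<j₀ (y , y<x , sym qx≡qy))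

module _ {n} (G : SimpleGraph n) where

  Joins : Fin (edgeCount G) → Fin n → Fin n → Set
  Joins e u v = ends G e ≡ (u , v) ⊎ ends G e ≡ (v , u)

  ends≡⇒< : ∀ {e u v} → ends G e ≡ (u , v) → u Fin.< v
  ends≡⇒< {e} e≡uv = subst (λ (x , y) → x Fin.< y) e≡uv (ordered G e)

  ¬Joins-loop : ∀ {e u} → ¬ Joins e u u
  ¬Joins-loop (inj₁ e≡uu) = <-irrefl refl (ends≡⇒< e≡uu)
  ¬Joins-loop (inj₂ e≡uu) = <-irrefl refl (ends≡⇒< e≡uu)

  Joins-unique : ∀ {e f u v} → Joins e u v → Joins f u v → e ≡ f
  Joins-unique (inj₁ e≡uv) (inj₁ f≡uv) = noMulti G (trans e≡uv (sym f≡uv))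
  Joins-unique (inj₂ e≡vu) (inj₂ f≡vu) = noMulti G (trans e≡vu (sym f≡vu))
  Joins-unique (inj₁ e≡uv) (inj₂ f≡vu) = ⊥-elim (<-asym (ends≡⇒< e≡uv) (ends≡⇒< f≡vu))
  Joins-unique (inj₂ e≡vu) (inj₁ f≡uv) = ⊥-elim (<-asym (ends≡⇒< e≡vu) (ends≡⇒< f≡uv))

  record NonBacktrackingWalk : Set where
    field
      vertex          : ℕ → Fin n
      edge            : ℕ → Fin (edgeCount G)
      joins           : ∀ k → Joins (edge k) (vertex k) (vertex (suc k))
      nonBacktracking : ∀ k → edge (suc k) ≢ edge k
  open NonBacktrackingWalk

  dropWalk : ℕ → NonBacktrackingWalk → NonBacktrackingWalk
  dropWalk i W = record
    { vertex          = λ k → vertex W (i + k)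
    ; edge            = λ k → edge W (i + k)
    ; joins           = λ k → subst (Joins (edge W (i + k)) (vertex W (i + k)) ∘ vertex W)
                                    (sym (+-suc i k)) (joins W (i + k))
    ; nonBacktracking = λ k eq → nonBacktracking W (i + k) (trans (cong (edge W) (sym (+-suc i k))) eq)
    }

  -- A closed walk of length 1 would be a loop and one of length 2 would use
  -- an edge twice in a row.
  closedWalk⇒Cycle : (W : NonBacktrackingWalk) (L : ℕ) → vertex W (suc L) ≡ vertex W 0 →
                     (∀ {x y} → x < suc L → y < suc L → vertex W x ≡ vertex W y → x ≡ y) → Cycle G
  closedWalk⇒Cycle W zero closes _ =
    ⊥-elim (¬Joins-loop (subst (Joins (edge W 0) (vertex W 0)) closes (joins W 0)))
  closedWalk⇒Cycle W (suc zero) closes _ =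
    ⊥-elim (nonBacktracking W 0
      (Joins-unique (⊎-swap (subst (Joins (edge W 1) (vertex W 1)) closes (joins W 1))) (joins W 0)))
  closedWalk⇒Cycle W (suc (suc k)) closes distinct = record
    { k     = k
    ; vert  = vertex W ∘ toℕ
    ; inj   = λ {x} {y} eq → toℕ-injective (distinct (toℕ<n x) (toℕ<n y) eq)
    ; step  = λ i → subst (λ j → Adj G (vertex W j) (vertex W (suc (toℕ i))))
                          (sym (toℕ-inject₁ i)) (edge W (toℕ i) , joins W (toℕ i))
    ; close = subst (λ j → Adj G (vertex W j) (vertex W 0)) (sym (toℕ-fromℕ (suc (suc k))))
                    (edge W (suc (suc k)) , subst (Joins _ _) closes (joins W (suc (suc k))))
    }

  nonBacktrackingWalk⇒Cycle : NonBacktrackingWalk → Cycle G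
  nonBacktrackingWalk⇒Cycle W with firstRepetition (vertex W)
  ... | i , j , i<j , returns , injective with m≤n⇒∃[o]m+o≡n i<j
  ... | L , i+1+L≡j = closedWalk⇒Cycle (dropWalk i W) L closes distinct
    where
    i+[1+L]≡j : i + suc L ≡ j
    i+[1+L]≡j = trans (+-suc i L) i+1+L≡j

    closes : vertex W (i + suc L) ≡ vertex W (i + 0)
    closes = begin
      vertex W (i + suc L)  ≡⟨ cong (vertex W) i+[1+L]≡j ⟩
      vertex W j            ≡⟨ returns ⟨
      vertex W i            ≡⟨ cong (vertex W) (+-identityʳ i) ⟨
      vertex W (i + 0)      ∎
      where open ≡-Reasoning

    below-j : ∀ {x} → x < suc L → i + x < j
    below-j {x} x<1+L = subst (i + x <_) i+[1+L]≡j (+-monoʳ-< i x<1+L)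

    distinct : ∀ {x y} → x < suc L → y < suc L → vertex W (i + x) ≡ vertex W (i + y) → x ≡ y
    distinct x<1+L y<1+L eq = +-cancelˡ-≡ i _ _ (injective (below-j x<1+L) (below-j y<1+L) eq)

module _ {n} (F : SimpleGraph n) where
  private
    E = edgeCount F

  IsEnd : Fin n → Fin E → Set
  IsEnd v e = v ≡ proj₁ (ends F e) ⊎ v ≡ proj₂ (ends F e)

  IsEnd? : ∀ v e → Dec (IsEnd v e)
  IsEnd? v e = (v Fin.≟ proj₁ (ends F e)) ⊎-dec (v Fin.≟ proj₂ (ends F e))

  ∈incident⁺ : ∀ {e v} → IsEnd v e → e ∈ incident F v
  ∈incident⁺ {e} {v} v-end =
    lookup⇒[]= e (incident F v) (trans (lookup∘tabulate _ e) (dec-true (IsEnd? v e) v-end))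

  ∈incident⁻ : ∀ {e} v → e ∈ incident F v → IsEnd v e
  ∈incident⁻ {e} v e∋v =
    invert (subst (Reflects (IsEnd v e)) (trans (sym (lookup∘tabulate _ e)) ([]=⇒lookup e∋v)) (proof (IsEnd? v e)))

  otherEnd : ∀ {e} v → e ∈ incident F v → ∃ (Joins F e v)
  otherEnd {e} v e∋v with ∈incident⁻ v e∋v
  ... | inj₁ v≡end₁ = proj₂ (ends F e) , inj₁ (cong (_, proj₂ (ends F e)) (sym v≡end₁))
  ... | inj₂ v≡end₂ = proj₁ (ends F e) , inj₂ (cong (proj₁ (ends F e) ,_) (sym v≡end₂))

  Joins⇒∈incidentʳ : ∀ {e u v} → Joins F e u v → e ∈ incident F v
  Joins⇒∈incidentʳ (inj₁ e≡uv) = ∈incident⁺ (inj₂ (cong proj₂ (sym e≡uv)))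
  Joins⇒∈incidentʳ (inj₂ e≡vu) = ∈incident⁺ (inj₁ (cong proj₁ (sym e≡vu)))

  Joins⇒ends : ∀ {e u v} x → Joins F e u v → e ∈ incident F x → x ≡ u ⊎ x ≡ v
  Joins⇒ends x joins e∋x with ∈incident⁻ x e∋x | joins
  ... | inj₁ x≡end₁ | inj₁ e≡uv = inj₁ (trans x≡end₁ (cong proj₁ e≡uv))
  ... | inj₂ x≡end₂ | inj₁ e≡uv = inj₂ (trans x≡end₂ (cong proj₂ e≡uv))
  ... | inj₁ x≡end₁ | inj₂ e≡vu = inj₂ (trans x≡end₁ (cong proj₁ e≡vu))
  ... | inj₂ x≡end₂ | inj₂ e≡vu = inj₁ (trans x≡end₂ (cong proj₂ e≡vu))

  OnlyEdgeAt : Subset E → Fin n → Fin E → Set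
  OnlyEdgeAt S v a = ∀ e → e ∈ S → e ∈ incident F v → e ≡ a

  OtherEdgeAt : Subset E → Fin n → Fin E → Set
  OtherEdgeAt S v a = ∃ λ e → e ∈ S × e ≢ a × e ∈ incident F v

  OtherEdgeAt? : ∀ S v a → Dec (OtherEdgeAt S v a)
  OtherEdgeAt? S v a = any? λ e → e ∈? S ×-dec ¬? (e Fin.≟ a) ×-dec e ∈? incident F v

  ¬OtherEdgeAt⇒OnlyEdgeAt : ∀ {S v a} → ¬ OtherEdgeAt S v a → OnlyEdgeAt S v a
  ¬OtherEdgeAt⇒OnlyEdgeAt {a = a} noOther e e∈S e∋v =
    decidable-stable (e Fin.≟ a) λ e≢a → noOther (e , e∈S , e≢a , e∋v)

  PendantEdge : Subset E → Fin n → Fin E → Set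
  PendantEdge S v a = a ∈ S × a ∈ incident F v × OnlyEdgeAt S v a

  NoPendantEdge : Subset E → Set
  NoPendantEdge S = ∀ v {a} → a ∈ S → a ∈ incident F v → OtherEdgeAt S v a

  pendantEdge-or-none : ∀ S → ∃₂ (PendantEdge S) ⊎ NoPendantEdge S
  pendantEdge-or-none S
    with any? (λ v → any? λ a → a ∈? S ×-dec a ∈? incident F v ×-dec ¬? (OtherEdgeAt? S v a))
  ... | yes (v , a , a∈S , a∋v , noOther) = inj₁ (v , a , a∈S , a∋v , ¬OtherEdgeAt⇒OnlyEdgeAt {v = v} noOther)
  ... | no none = inj₂ λ v {a} a∈S a∋v →
    decidable-stable (OtherEdgeAt? S v a) λ noOther → none (v , a , a∈S , a∋v , noOther)

  -- Leave each edge through its other end by a different edge.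
  noPendantEdge⇒Walk : ∀ {S a} → NoPendantEdge S → a ∈ S → NonBacktrackingWalk F
  noPendantEdge⇒Walk {S} {a} noPendant a∈S = record
    { vertex          = proj₁ ∘ proj₁ ∘ darts
    ; edge            = proj₂ ∘ proj₁ ∘ darts
    ; joins           = λ k → proj₁ (proj₂ (turn (darts k)))
    ; nonBacktracking = λ k → proj₂ (proj₂ (turn (darts k)))
    }
    where
    Dart : Set
    Dart = Σ (Fin n × Fin E) λ (v , e) → e ∈ S × e ∈ incident F v

    turn : (d : Dart) → Σ Dart λ d′ →
           Joins F (proj₂ (proj₁ d)) (proj₁ (proj₁ d)) (proj₁ (proj₁ d′)) × proj₂ (proj₁ d′) ≢ proj₂ (proj₁ d)
    turn ((v , e) , e∈S , e∋v) =
      let w , e-joins = otherEnd v e∋v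
          e′ , e′∈S , e′≢e , e′∋w = noPendant w e∈S (Joins⇒∈incidentʳ e-joins)
      in ((w , e′) , e′∈S , e′∋w) , e-joins , e′≢e

    darts : ℕ → Dart
    darts zero    = (proj₁ (ends F a) , a) , a∈S , ∈incident⁺ (inj₁ refl)
    darts (suc k) = proj₁ (turn (darts k))

  forest⇒pendantEdge : IsForest F → ∀ {S a} → a ∈ S → ∃₂ (PendantEdge S)
  forest⇒pendantEdge forest {S} a∈S with pendantEdge-or-none S
  ... | inj₁ pendant   = pendant
  ... | inj₂ noPendant = ⊥-elim (forest (nonBacktrackingWalk⇒Cycle F (noPendantEdge⇒Walk noPendant a∈S)))

  Dominates : Subset E → Fin E → Fin E → Set
  Dominates S a b = ∀ v → a ∈ incident F v → b ∈ incident F v ⊎ OnlyEdgeAt S v a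

  record DominatingPair (S : Subset E) : Set where
    field
      dominant dominated : Fin E
      dominant∈S         : dominant ∈ S
      dominated∈S        : dominated ∈ S
      distinct           : dominant ≢ dominated
      dominates          : Dominates S dominant dominated

  -- Take a pendant edge a = vw at the leaf v; a dominates any other edge at w,
  -- and if there is none, a is isolated in S and dominates every edge.
  forest⇒DominatingPair : IsForest F → ∀ {S u u′} → u ∈ S → u′ ∈ S → u ≢ u′ → DominatingPair S
  forest⇒DominatingPair forest {S} {u} {u′} u∈S u′∈S u≢u′
    with forest⇒pendantEdge forest u∈S
  ... | v , a , a∈S , a∋v , onlyAtV
    with otherEnd v a∋v
  ... | w , a-joins
    with OtherEdgeAt? S w a
  ... | yes (b , b∈S , b≢a , b∋w) = record
    { dominant = a ; dominated = b ; dominant∈S = a∈S ; dominated∈S = b∈S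
    ; distinct = b≢a ∘ sym
    ; dominates = λ x a∋x → case Joins⇒ends x a-joins a∋x of λ
        { (inj₁ refl) → inj₂ onlyAtV
        ; (inj₂ refl) → inj₁ b∋w }
    }
  ... | no noOther = record
    { dominant = a ; dominated = proj₁ other ; dominant∈S = a∈S ; dominated∈S = proj₁ (proj₂ other)
    ; distinct = proj₂ (proj₂ other) ∘ sym
    ; dominates = λ x a∋x → inj₂ (case Joins⇒ends x a-joins a∋x of λ
        { (inj₁ refl) → onlyAtV
        ; (inj₂ refl) → ¬OtherEdgeAt⇒OnlyEdgeAt {v = w} noOther })
    }
    where
    other : ∃ λ b → b ∈ S × b ≢ a
    other with u Fin.≟ a
    ... | yes refl = u′ , u′∈S , u≢u′ ∘ sym
    ... | no u≢a   = u , u∈S , u≢a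

module _ {n} (F : SimpleGraph n) where
  open ≤-Reasoning

  private
    E = edgeCount F

  BD↾ : Subset E → (Fin n → ℕ) → Complex E
  BD↾ S λ' τ = τ ⊆ S × BD λ' F τ

  BD↾⊤≋BD : ∀ λ' → BD↾ ⊤ λ' ≋ BD λ' F
  BD↾⊤≋BD λ' = (λ _ → proj₂) , λ _ bounded → ⊆⊤ , bounded

  BD↾-downClosed : ∀ {S λ'} → IsDownClosed (BD↾ S λ')
  BD↾-downClosed σ τ τ⊆σ (σ⊆S , σ-bounded) =
    σ⊆S ∘ τ⊆σ , λ v → ≤-trans (∣p∩r∣≤∣q∩r∣ (incident F v) τ⊆σ) (σ-bounded v)

  vertex∈S : ∀ {S λ' e} → IsVertex (BD↾ S λ') e → e ∈ S
  vertex∈S {e = e} (⁅e⁆⊆S , _) = ⁅e⁆⊆S (x∈⁅x⁆ e)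

  IsVertex? : ∀ S λ' e → Dec (IsVertex (BD↾ S λ') e)
  IsVertex? S λ' e = ⁅ e ⁆ ⊆? S ×-dec all? (λ v → degree F ⁅ e ⁆ v ≤? λ' v)

  degree-∪⁅⁆ : ∀ {τ b} v → b ∉ τ → degree F (τ ∪ ⁅ b ⁆) v ≡ degree F τ v + degree F ⁅ b ⁆ v
  degree-∪⁅⁆ {τ} {b} v b∉τ = ∣[p∪q]∩r∣≡∣p∩r∣+∣q∩r∣ τ ⁅ b ⁆ (incident F v)
    λ x∈τ x∈⁅b⁆ → b∉τ (subst (_∈ τ) (x∈⁅y⁆⇒x≡y b x∈⁅b⁆) x∈τ)

  deletion-BD↾ : ∀ {S λ'} b → deletion (BD↾ S λ') b ≋ BD↾ (S - b) λ'
  deletion-BD↾ b =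
    (λ τ (b∉τ , τ⊆S , bounded) → (λ x∈τ → x∈p∧x≢y⇒x∈p-y (τ⊆S x∈τ) λ { refl → b∉τ x∈τ }) , bounded) ,
    (λ τ (τ⊆S-b , bounded) → (λ b∈τ → x∈p-y⇒x≢y (τ⊆S-b b∈τ) refl) , x∈p-y⇒x∈p ∘ τ⊆S-b , bounded)

  link-BD↾ : ∀ {S λ' b} → IsVertex (BD↾ S λ') b →
             link (BD↾ S λ') b ≋ BD↾ (S - b) (λ v → λ' v ∸ degree F ⁅ b ⁆ v)
  link-BD↾ {S} {λ'} {b} (⁅b⁆⊆S , b-bounded) = to , from
    where
    to : link (BD↾ S λ') b ⊑ BD↾ (S - b) (λ v → λ' v ∸ degree F ⁅ b ⁆ v)
    to τ (b∉τ , τ∪b⊆S , bounded) =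
      (λ x∈τ → x∈p∧x≢y⇒x∈p-y (τ∪b⊆S (p⊆p∪q _ x∈τ)) λ { refl → b∉τ x∈τ }) ,
      λ v → m+n≤o⇒m≤o∸n _ (subst (_≤ λ' v) (degree-∪⁅⁆ v b∉τ) (bounded v))

    from : BD↾ (S - b) (λ v → λ' v ∸ degree F ⁅ b ⁆ v) ⊑ link (BD↾ S λ') b
    from τ (τ⊆S-b , bounded) = b∉τ , ∪-lub (x∈p-y⇒x∈p ∘ τ⊆S-b) ⁅b⁆⊆S , λ v → begin
      degree F (τ ∪ ⁅ b ⁆) v                        ≡⟨ degree-∪⁅⁆ v b∉τ ⟩
      degree F τ v + degree F ⁅ b ⁆ v               ≤⟨ +-monoˡ-≤ _ (bounded v) ⟩
      λ' v ∸ degree F ⁅ b ⁆ v + degree F ⁅ b ⁆ v   ≡⟨ m∸n+n≡m (b-bounded v) ⟩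
      λ' v                                          ∎
      where
      b∉τ : b ∉ τ
      b∉τ b∈τ = x∈p-y⇒x≢y (τ⊆S-b b∈τ) refl

  dominates⇒replaceable : ∀ {S λ' a b} → a ∈ S → IsVertex (BD↾ S λ') a → Dominates F S a b →
                          Replaceable (BD↾ S λ') b a
  dominates⇒replaceable {S} {λ'} {a} {b} a∈S (_ , a-bounded) dominates σ a∉σ b∉σ (σ∪b⊆S , σ∪b-bounded) =
    ∪-lub σ⊆S (x∈p⇒⁅x⁆⊆p a∈S) , bounded
    where
    σ⊆S : σ ⊆ S
    σ⊆S = σ∪b⊆S ∘ p⊆p∪q _

    bounded : ∀ v → degree F (σ ∪ ⁅ a ⁆) v ≤ λ' v
    bounded v with a ∈? incident F v
    ... | no a∉v = begin
      degree F (σ ∪ ⁅ a ⁆) v           ≡⟨ degree-∪⁅⁆ v a∉σ ⟩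
      degree F σ v + degree F ⁅ a ⁆ v  ≡⟨ cong (degree F σ v +_) (x∉p⇒∣⁅x⁆∩p∣≡0 _ a∉v) ⟩
      degree F σ v + 0                 ≤⟨ +-monoʳ-≤ (degree F σ v) z≤n ⟩
      degree F σ v + degree F ⁅ b ⁆ v  ≡⟨ degree-∪⁅⁆ v b∉σ ⟨
      degree F (σ ∪ ⁅ b ⁆) v           ≤⟨ σ∪b-bounded v ⟩
      λ' v                             ∎
    ... | yes a∈v with dominates v a∈v
    ...   | inj₁ b∈v = begin
      degree F (σ ∪ ⁅ a ⁆) v           ≡⟨ degree-∪⁅⁆ v a∉σ ⟩
      degree F σ v + degree F ⁅ a ⁆ v  ≡⟨ cong (degree F σ v +_) (x∈p⇒∣⁅x⁆∩p∣≡1 a∈v) ⟩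
      degree F σ v + 1                 ≡⟨ cong (degree F σ v +_) (x∈p⇒∣⁅x⁆∩p∣≡1 b∈v) ⟨
      degree F σ v + degree F ⁅ b ⁆ v  ≡⟨ degree-∪⁅⁆ v b∉σ ⟨
      degree F (σ ∪ ⁅ b ⁆) v           ≤⟨ σ∪b-bounded v ⟩
      λ' v                             ∎
    ...   | inj₂ onlyA = ≤-trans (p⊆q⇒∣p∣≤∣q∣ only-a) (a-bounded v)
      where
      only-a : (σ ∪ ⁅ a ⁆) ∩ incident F v ⊆ ⁅ a ⁆ ∩ incident F v
      only-a {x} x∈[σ∪a]∩v with x∈p∩q⁻ (σ ∪ ⁅ a ⁆) _ x∈[σ∪a]∩v
      ... | x∈σ∪a , x∈v = x∈p∩q⁺ (subst (_∈ ⁅ a ⁆) (sym x≡a) (x∈⁅x⁆ a) , x∈v)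
        where
        x≡a : x ≡ a
        x≡a = onlyA x (∪-lub σ⊆S (x∈p⇒⁅x⁆⊆p a∈S) x∈σ∪a) x∈v

  BD↾-grape : IsForest F → ∀ S λ' → Grape (BD↾ S λ')
  BD↾-grape forest = All.wfRec (wellFounded ∣_∣ <-wellFounded) _ (λ S → ∀ λ' → Grape (BD↾ S λ')) step
    where
    step : ∀ S → (∀ {S′} → ∣ S′ ∣ < ∣ S ∣ → ∀ λ' → Grape (BD↾ S′ λ')) → ∀ λ' → Grape (BD↾ S λ')
    step S smaller λ' with any? (λ e → e ∈? S ×-dec ¬? (IsVertex? S λ' e))
    ... | yes (e , e∈S , e∉K) =
      Grape-resp-≋ (≋-sym (≋-trans (¬IsVertex⇒≋deletion BD↾-downClosed e∉K) (deletion-BD↾ e)))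
                   (smaller (x∈p⇒∣p-x∣<∣p∣ e∈S) λ')
    ... | no allVertices with any? (λ u → any? λ u′ → u ∈? S ×-dec u′ ∈? S ×-dec ¬? (u Fin.≟ u′))
    ...   | no noTwo = small λ u u′ u∈K u′∈K → decidable-stable (u Fin.≟ u′) λ u≢u′ →
      noTwo (u , u′ , vertex∈S u∈K , vertex∈S u′∈K , u≢u′)
    ...   | yes (u , u′ , u∈S , u′∈S , u≢u′) =
      decompose b (isVertex dominated∈S)
        (replaceable⇒LinkInCone BD↾-downClosed distinct (isVertex dominated∈S)
          (dominates⇒replaceable dominant∈S (isVertex dominant∈S) dominates))
        (Grape-resp-≋ (≋-sym (link-BD↾ (isVertex dominated∈S))) (smaller (x∈p⇒∣p-x∣<∣p∣ dominated∈S) _))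
        (Grape-resp-≋ (≋-sym (deletion-BD↾ b)) (smaller (x∈p⇒∣p-x∣<∣p∣ dominated∈S) λ'))
      where
      open DominatingPair (forest⇒DominatingPair F forest u∈S u′∈S u≢u′) renaming (dominated to b)

      isVertex : ∀ {e} → e ∈ S → IsVertex (BD↾ S λ') e
      isVertex {e} e∈S = decidable-stable (IsVertex? S λ' e) λ e∉K → allVertices (e , e∈S , e∉K)

lemma3p1 : ∀ (n : ℕ) (F : SimpleGraph n) → IsForest F →
    (λ' : Fin n → ℕ) → Grape (BD λ' F)
lemma3p1 n F forest λ' = Grape-resp-≋ (BD↾⊤≋BD F λ') (BD↾-grape F forest ⊤ λ')
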